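{- Let $m,n$ be positive integers and let $h=\lceil (m+1)/2\rceil$. No latin square of order $n$ has more than \[ \frac{n\binom{n}{h}}{m\binom{m}{h}} \] subsquares of order $m$.
   Context: A latin square of order $n$ is an $n\times n$ matrix on $n$ symbols in which each symbol occurs exactly once in each row and each column. A subsquare of a latin square $L$ is a submatrix of $L$ (obtained by selecting some set of rows and some set of columns, not necessarily contiguous) that is itself a latin square; its order is its number of rows. -}

module Defs where

open import Data.Nat using (ℕ)
open import Data.Fin using (Fin)
open import Data.Fin.Subset using (Subset; _∈_; ∣_∣)
open import Data.Product using (Σ; _×_)
open import Relation.Binary.PropositionalEquality using (_≡_)

Matrix : ℕ → Set
Matrix n = Fin n → Fin n → Fin n

IsLatinSquare : ∀ {n} → Matrix n → Set
IsLatinSquare {n} L =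
  (∀ (i s : Fin n) → Σ (Fin n) λ j → L i j ≡ s × (∀ j′ → L i j′ ≡ s → j′ ≡ j)) ×
  (∀ (j s : Fin n) → Σ (Fin n) λ i → L i j ≡ s × (∀ i′ → L i′ j ≡ s → i′ ≡ i))

IsSubsquare : ∀ {n} → Matrix n → ℕ → Subset n → Subset n → Set
IsSubsquare {n} L m R C =
  ∣ R ∣ ≡ m × ∣ C ∣ ≡ m ×
  Σ (Subset n) λ S →
    ∣ S ∣ ≡ m ×
    (∀ i j → i ∈ R → j ∈ C → L i j ∈ S) ×
    (∀ i s → i ∈ R → s ∈ S →
       Σ (Fin n) λ j → j ∈ C × L i j ≡ s × (∀ j′ → j′ ∈ C → L i j′ ≡ s → j′ ≡ j)) ×
    (∀ j s → j ∈ C → s ∈ S →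
       Σ (Fin n) λ i → i ∈ R × L i j ≡ s × (∀ i′ → i′ ∈ R → L i′ j ≡ s → i′ ≡ i))

-- Call a pair (r, A) of a row r and a set A of h columns a flag.  A subsquare
-- (R, C) of order m contains the m · C(m, h) flags with r ∈ R and A ⊆ C, and
-- there are n · C(n, h) flags in all, so it suffices that no flag lies in two
-- distinct subsquares.  If it did, the symbol s₀ = L r a₀ (a₀ ∈ A) occurs in
-- every column a ∈ A at a row ρ a of both subsquares.  A column j₀ ∈ C₁ ∖ C₂
-- would give, for a ∈ A, the symbols L r a and L (ρ a) j₀ of the first
-- subsquare: each family is injective, and they are disjoint since only the
-- former are symbols of the second subsquare.  That is 2h > m symbols, so the
-- column sets agree, and then so do the row sets.
module Submission where

open import Defs
open import Data.Nat using (ℕ; _*_; _≤_; ⌈_/2⌉; suc)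
open import Data.Nat.Combinatorics using (_C_)
open import Data.Fin.Subset using (Subset)
open import Data.Product using (_×_; proj₁; proj₂)
open import Data.List using (List; length)
open import Data.List.Relation.Unary.All using (All)
open import Data.List.Relation.Unary.Unique.Propositional using (Unique)

open import Data.Bool using (if_then_else_)
open import Data.Empty using (⊥-elim)
open import Data.Fin using (Fin; zero; suc)
import Data.Fin.Properties as Finₚ
open import Data.Fin.Subset using (_∈_; _⊆_; ∣_∣; ⊤; inside; outside)
open import Data.Fin.Subset.Properties
  using (_∈?_; _⊆?_; ⊆-antisym; ⊆⊤; ∈⊤; ∣⊤∣≡n; ∣⊥∣≡0; nonempty?; Empty-unique)
open import Data.List using ([]; _∷_; map)
open import Data.List.Relation.Unary.All using ([]; _∷_)
import Data.List.Relation.Unary.All as All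
open import Data.List.Relation.Unary.AllPairs using ([]; _∷_)
open import Data.Nat using (zero; _+_; _<_; z≤n; ⌊_/2⌋)
open import Data.Nat.Combinatorics using (nCk+nC[k+1]≡[n+1]C[k+1])
open import Data.Nat.ListAction using () renaming (sum to sumˡ)
open import Data.Nat.Properties
  using (+-*-semiring; +-commutativeSemigroup; _≟_; +-comm; +-identityʳ; *-identityʳ; *-zeroʳ;
         *-distribˡ-+; +-mono-≤; +-monoˡ-≤; ≤-reflexive; <⇒≱; n≮0;
         ⌊n/2⌋≤⌈n/2⌉; ⌊n/2⌋+⌈n/2⌉≡n; module ≤-Reasoning)
open import Data.Product using (∃; _,_)
open import Data.Vec using ([]; _∷_)
open import Function using (_∘_)
open import Relation.Binary.PropositionalEquality
  using (_≡_; _≢_; refl; sym; trans; cong; cong₂; subst; module ≡-Reasoning)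
open import Relation.Nullary using (Dec; yes; no; does; ¬_)
open import Relation.Nullary.Decidable using (_×-dec_; dec-true)
open import Relation.Unary using (Pred; Decidable)

open import Algebra.Properties.Semiring.Sum +-*-semiring
  using (sum-syntax; sum-cong-≗; ∑-distrib-+; ∑-comm; *-distribˡ-sum; *-distribʳ-sum; sum-replicate-zero)
open import Algebra.Properties.CommutativeSemigroup +-commutativeSemigroup using (interchange)

𝟙 : ∀ {a} {A : Set a} → Dec A → ℕ
𝟙 a? = if does a? then 1 else 0

𝟙-×-dec : ∀ {a b} {A : Set a} {B : Set b} (a? : Dec A) (b? : Dec B) → 𝟙 (a? ×-dec b?) ≡ 𝟙 a? * 𝟙 b?
𝟙-×-dec (yes _) b? = sym (+-identityʳ (𝟙 b?))
𝟙-×-dec (no _)  b? = refl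

∑-mono : ∀ {n} {f g : Fin n → ℕ} → (∀ i → f i ≤ g i) → ∑[ i < n ] f i ≤ ∑[ i < n ] g i
∑-mono {zero}  f≤g = z≤n
∑-mono {suc n} f≤g = +-mono-≤ (f≤g zero) (∑-mono (λ i → f≤g (suc i)))

∑-𝟙-none : ∀ {n p} {P : Pred (Fin n) p} (P? : Decidable P) → (∀ i → ¬ P i) → ∑[ i < n ] 𝟙 (P? i) ≡ 0
∑-𝟙-none {n} P? ∄P = trans (sum-cong-≗ 𝟙≡0) (sum-replicate-zero n)
  where
  𝟙≡0 : ∀ i → 𝟙 (P? i) ≡ 0
  𝟙≡0 i with P? i
  ... | yes Pi = ⊥-elim (∄P i Pi)
  ... | no _   = refl

∑-𝟙-≤1 : ∀ {n p} {P : Pred (Fin n) p} (P? : Decidable P) →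
         (∀ {i j} → P i → P j → i ≡ j) → ∑[ i < n ] 𝟙 (P? i) ≤ 1
∑-𝟙-≤1 {zero}  P? unique = z≤n
∑-𝟙-≤1 {suc n} P? unique with P? zero
... | yes P0 = ≤-reflexive (cong suc (∑-𝟙-none (λ i → P? (suc i)) (λ i Pi → Finₚ.0≢1+n (unique P0 Pi))))
... | no _   = ∑-𝟙-≤1 (λ i → P? (suc i)) (λ Pi Pj → Finₚ.suc-injective (unique Pi Pj))

∑-𝟙-≟ : ∀ {n} (i : Fin n) → ∑[ j < n ] 𝟙 (i Finₚ.≟ j) ≡ 1
∑-𝟙-≟ {suc n} zero    = cong suc (sum-replicate-zero n)
∑-𝟙-≟         (suc i) = ∑-𝟙-≟ i

∣p∣≡∑𝟙[∈] : ∀ {n} (p : Subset n) → ∣ p ∣ ≡ ∑[ i < n ] 𝟙 (i ∈? p)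
∣p∣≡∑𝟙[∈] []            = refl
∣p∣≡∑𝟙[∈] (inside  ∷ p) = cong suc (∣p∣≡∑𝟙[∈] p)
∣p∣≡∑𝟙[∈] (outside ∷ p) = ∣p∣≡∑𝟙[∈] p

InjectiveOn : ∀ {m n} → Subset m → (Fin m → Fin n) → Set
InjectiveOn p f = ∀ {x x′} → x ∈ p → x′ ∈ p → f x ≡ f x′ → x ≡ x′

fibre : ∀ {m n} → (Fin m → Fin n) → Subset m → Fin n → ℕ
fibre {m} f p y = ∑[ x < m ] 𝟙 (x ∈? p ×-dec f x Finₚ.≟ y)

∑-fibre : ∀ {m n} (f : Fin m → Fin n) (p : Subset m) → ∑[ y < n ] fibre f p y ≡ ∣ p ∣
∑-fibre {m} {n} f p = begin
  ∑[ y < n ] ∑[ x < m ] 𝟙 (x ∈? p ×-dec f x Finₚ.≟ y)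
    ≡⟨ ∑-comm (λ x y → 𝟙 (x ∈? p ×-dec f x Finₚ.≟ y)) ⟨
  ∑[ x < m ] ∑[ y < n ] 𝟙 (x ∈? p ×-dec f x Finₚ.≟ y)
    ≡⟨ sum-cong-≗ (λ x → sum-cong-≗ {n} (λ y → 𝟙-×-dec (x ∈? p) (f x Finₚ.≟ y))) ⟩
  ∑[ x < m ] ∑[ y < n ] (𝟙 (x ∈? p) * 𝟙 (f x Finₚ.≟ y))
    ≡⟨ sum-cong-≗ (λ x → *-distribˡ-sum {n} (𝟙 (x ∈? p)) _) ⟨
  ∑[ x < m ] (𝟙 (x ∈? p) * ∑[ y < n ] 𝟙 (f x Finₚ.≟ y))
    ≡⟨ sum-cong-≗ (λ x → cong (𝟙 (x ∈? p) *_) (∑-𝟙-≟ (f x))) ⟩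
  ∑[ x < m ] (𝟙 (x ∈? p) * 1)
    ≡⟨ sum-cong-≗ (λ x → *-identityʳ (𝟙 (x ∈? p))) ⟩
  ∑[ x < m ] 𝟙 (x ∈? p)
    ≡⟨ ∣p∣≡∑𝟙[∈] p ⟨
  ∣ p ∣ ∎
  where open ≡-Reasoning

fibre-≤1 : ∀ {m n} {f : Fin m → Fin n} {p : Subset m} → InjectiveOn p f → ∀ y → fibre f p y ≤ 1
fibre-≤1 {f = f} {p} f-inj y =
  ∑-𝟙-≤1 (λ x → x ∈? p ×-dec f x Finₚ.≟ y)
    (λ (x∈p , fx≡y) (x′∈p , fx′≡y) → f-inj x∈p x′∈p (trans fx≡y (sym fx′≡y)))

fibre≡0 : ∀ {m n} {f : Fin m → Fin n} {p : Subset m} {y} →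
          (∀ {x} → x ∈ p → f x ≢ y) → fibre f p y ≡ 0
fibre≡0 {f = f} {p} {y} ∉fibre =
  ∑-𝟙-none (λ x → x ∈? p ×-dec f x Finₚ.≟ y) (λ x (x∈p , fx≡y) → ∉fibre x∈p fx≡y)

∣p∣+∣p′∣≤∣q∣ : ∀ {k l n} {p : Subset k} {p′ : Subset l} (q : Subset n)
              {f : Fin k → Fin n} {g : Fin l → Fin n} →
              (∀ {x} → x ∈ p → f x ∈ q) → (∀ {x} → x ∈ p′ → g x ∈ q) →
              InjectiveOn p f → InjectiveOn p′ g → (∀ {x x′} → x ∈ p → x′ ∈ p′ → f x ≢ g x′) →
              ∣ p ∣ + ∣ p′ ∣ ≤ ∣ q ∣
∣p∣+∣p′∣≤∣q∣ {n = n} {p} {p′} q {f} {g} f∈q g∈q f-inj g-inj disjoint = begin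
  ∣ p ∣ + ∣ p′ ∣                                     ≡⟨ cong₂ _+_ (∑-fibre f p) (∑-fibre g p′) ⟨
  ∑[ y < n ] fibre f p y + ∑[ y < n ] fibre g p′ y   ≡⟨ ∑-distrib-+ (fibre f p) (fibre g p′) ⟨
  ∑[ y < n ] (fibre f p y + fibre g p′ y)            ≤⟨ ∑-mono fibres≤ ⟩
  ∑[ y < n ] 𝟙 (y ∈? q)                              ≡⟨ ∣p∣≡∑𝟙[∈] q ⟨
  ∣ q ∣                                              ∎
  where
  open ≤-Reasoning

  fibres≤ : ∀ y → fibre f p y + fibre g p′ y ≤ 𝟙 (y ∈? q)
  fibres≤ y with y ∈? q | Finₚ.any? (λ x → x ∈? p ×-dec f x Finₚ.≟ y)
  ... | no y∉q | _ = ≤-reflexive (cong₂ _+_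
        (fibre≡0 (λ x∈p fx≡y → y∉q (subst (_∈ q) fx≡y (f∈q x∈p))))
        (fibre≡0 (λ x∈p′ gx≡y → y∉q (subst (_∈ q) gx≡y (g∈q x∈p′)))))
  ... | yes _ | yes (x , x∈p , fx≡y) = begin
        fibre f p y + fibre g p′ y
          ≡⟨ cong (fibre f p y +_)
               (fibre≡0 λ x′∈p′ gx′≡y → disjoint x∈p x′∈p′ (trans fx≡y (sym gx′≡y))) ⟩
        fibre f p y + 0             ≡⟨ +-identityʳ _ ⟩
        fibre f p y                 ≤⟨ fibre-≤1 f-inj y ⟩
        1                           ∎
  ... | yes _ | no ∄x = begin
        fibre f p y + fibre g p′ y
          ≡⟨ cong (_+ fibre g p′ y) (fibre≡0 (λ x∈p fx≡y → ∄x (_ , x∈p , fx≡y))) ⟩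
        fibre g p′ y                ≤⟨ fibre-≤1 g-inj y ⟩
        1                           ∎

∑ˢ : ∀ n → (Subset n → ℕ) → ℕ
∑ˢ zero    f = f []
∑ˢ (suc n) f = ∑ˢ n (λ A → f (outside ∷ A)) + ∑ˢ n (λ A → f (inside ∷ A))

∑ˢ-zero : ∀ n → ∑ˢ n (λ _ → 0) ≡ 0
∑ˢ-zero zero    = refl
∑ˢ-zero (suc n) = cong₂ _+_ (∑ˢ-zero n) (∑ˢ-zero n)

∑ˢ-cong : ∀ n {f g : Subset n → ℕ} → (∀ A → f A ≡ g A) → ∑ˢ n f ≡ ∑ˢ n g
∑ˢ-cong zero    f≡g = f≡g []
∑ˢ-cong (suc n) f≡g =
  cong₂ _+_ (∑ˢ-cong n (λ A → f≡g (outside ∷ A))) (∑ˢ-cong n (λ A → f≡g (inside ∷ A)))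

∑ˢ-mono : ∀ n {f g : Subset n → ℕ} → (∀ A → f A ≤ g A) → ∑ˢ n f ≤ ∑ˢ n g
∑ˢ-mono zero    f≤g = f≤g []
∑ˢ-mono (suc n) f≤g =
  +-mono-≤ (∑ˢ-mono n (λ A → f≤g (outside ∷ A))) (∑ˢ-mono n (λ A → f≤g (inside ∷ A)))

∑ˢ-distrib-+ : ∀ n (f g : Subset n → ℕ) → ∑ˢ n (λ A → f A + g A) ≡ ∑ˢ n f + ∑ˢ n g
∑ˢ-distrib-+ zero    f g = refl
∑ˢ-distrib-+ (suc n) f g = begin
  ∑ˢ n (λ A → f (o A) + g (o A)) + ∑ˢ n (λ A → f (i A) + g (i A))
    ≡⟨ cong₂ _+_ (∑ˢ-distrib-+ n (f ∘ o) (g ∘ o)) (∑ˢ-distrib-+ n (f ∘ i) (g ∘ i)) ⟩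
  (∑ˢ n (f ∘ o) + ∑ˢ n (g ∘ o)) + (∑ˢ n (f ∘ i) + ∑ˢ n (g ∘ i))
    ≡⟨ interchange (∑ˢ n (f ∘ o)) (∑ˢ n (g ∘ o)) (∑ˢ n (f ∘ i)) (∑ˢ n (g ∘ i)) ⟩
  (∑ˢ n (f ∘ o) + ∑ˢ n (f ∘ i)) + (∑ˢ n (g ∘ o) + ∑ˢ n (g ∘ i)) ∎
  where
  open ≡-Reasoning
  o i : Subset n → Subset (suc n)
  o = outside ∷_
  i = inside ∷_

*-distribˡ-∑ˢ : ∀ n c (f : Subset n → ℕ) → c * ∑ˢ n f ≡ ∑ˢ n (λ A → c * f A)
*-distribˡ-∑ˢ zero    c f = refl
*-distribˡ-∑ˢ (suc n) c f =
  trans (*-distribˡ-+ c _ _) (cong₂ _+_ (*-distribˡ-∑ˢ n c _) (*-distribˡ-∑ˢ n c _))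

∑ˢ-𝟙[⊆×∣∣≡] : ∀ {n} (p : Subset n) h →
               ∑ˢ n (λ A → 𝟙 (A ⊆? p ×-dec ∣ A ∣ ≟ h)) ≡ ∣ p ∣ C h
∑ˢ-𝟙[⊆×∣∣≡]         []            zero    = refl
∑ˢ-𝟙[⊆×∣∣≡]         []            (suc h) = refl
∑ˢ-𝟙[⊆×∣∣≡] {suc n} (outside ∷ p) h       =
  trans (cong₂ _+_ (∑ˢ-𝟙[⊆×∣∣≡] p h) (∑ˢ-zero n)) (+-identityʳ _)
∑ˢ-𝟙[⊆×∣∣≡] {suc n} (inside  ∷ p) zero    =
  cong₂ _+_ (∑ˢ-𝟙[⊆×∣∣≡] p zero) (trans (∑ˢ-cong n no-suc-∣∣≡0) (∑ˢ-zero n))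
  where
  no-suc-∣∣≡0 : ∀ A → 𝟙 (A ⊆? p ×-dec suc ∣ A ∣ ≟ 0) ≡ 0
  no-suc-∣∣≡0 A = trans (𝟙-×-dec (A ⊆? p) (suc ∣ A ∣ ≟ 0)) (*-zeroʳ (𝟙 (A ⊆? p)))
∑ˢ-𝟙[⊆×∣∣≡]         (inside  ∷ p) (suc h) = begin
  _                          ≡⟨ cong₂ _+_ (∑ˢ-𝟙[⊆×∣∣≡] p (suc h)) (∑ˢ-𝟙[⊆×∣∣≡] p h) ⟩
  ∣ p ∣ C suc h + ∣ p ∣ C h  ≡⟨ +-comm (∣ p ∣ C suc h) (∣ p ∣ C h) ⟩
  ∣ p ∣ C h + ∣ p ∣ C suc h  ≡⟨ nCk+nC[k+1]≡[n+1]C[k+1] ∣ p ∣ h ⟩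
  suc ∣ p ∣ C suc h          ∎
  where open ≡-Reasoning

sumˡ-𝟙-none : ∀ {a p} {K : Set a} {P : Pred K p} (P? : Decidable P) {ks} →
              All (¬_ ∘ P) ks → sumˡ (map (𝟙 ∘ P?) ks) ≡ 0
sumˡ-𝟙-none P? []               = refl
sumˡ-𝟙-none P? {k ∷ _} (¬Pk ∷ ¬Pks) with P? k
... | yes Pk = ⊥-elim (¬Pk Pk)
... | no _   = sumˡ-𝟙-none P? ¬Pks

sumˡ-𝟙≤𝟙 : ∀ {a p q b} {K : Set a} {P : Pred K p} {Q : Pred K q} {B : Set b}
           (P? : Decidable P) (B? : Dec B) {ks} → Unique ks → All Q ks →
           (∀ {k} → P k → B) → (∀ {k k′} → Q k → Q k′ → P k → P k′ → k ≡ k′) →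
           sumˡ (map (𝟙 ∘ P?) ks) ≤ 𝟙 B?
sumˡ-𝟙≤𝟙 P? B? [] [] P⇒B unique = z≤n
sumˡ-𝟙≤𝟙 P? B? {k ∷ _} (k∉ks ∷ distinct) (Qk ∷ Qks) P⇒B unique with P? k
... | no _   = sumˡ-𝟙≤𝟙 P? B? distinct Qks P⇒B unique
... | yes Pk rewrite dec-true B? (P⇒B Pk) =
  ≤-reflexive (cong suc (sumˡ-𝟙-none P?
    (All.zipWith (λ (k≢k′ , Qk′) Pk′ → k≢k′ (unique Qk Qk′ Pk Pk′)) (k∉ks , Qks))))

sumˡ-const : ∀ {a} {K : Set a} {g : K → ℕ} {c} {ks} →
             All (λ k → g k ≡ c) ks → sumˡ (map g ks) ≡ length ks * c
sumˡ-const []             = refl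
sumˡ-const (gk≡c ∷ gks≡c) = cong₂ _+_ gk≡c (sumˡ-const gks≡c)

∑∑ˢ-sumˡ-comm : ∀ {n a} {K : Set a} (g : K → Fin n → Subset n → ℕ) ks →
                ∑[ r < n ] ∑ˢ n (λ A → sumˡ (map (λ k → g k r A) ks)) ≡
                sumˡ (map (λ k → ∑[ r < n ] ∑ˢ n (g k r)) ks)
∑∑ˢ-sumˡ-comm {n} g []       = trans (sum-cong-≗ {n} (λ _ → ∑ˢ-zero n)) (sum-replicate-zero n)
∑∑ˢ-sumˡ-comm {n} g (k ∷ ks) = begin
  ∑[ r < n ] ∑ˢ n (λ A → g k r A + rest r A)
    ≡⟨ sum-cong-≗ (λ r → ∑ˢ-distrib-+ n (g k r) (rest r)) ⟩
  ∑[ r < n ] (∑ˢ n (g k r) + ∑ˢ n (rest r))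
    ≡⟨ ∑-distrib-+ (λ r → ∑ˢ n (g k r)) (λ r → ∑ˢ n (rest r)) ⟩
  ∑[ r < n ] ∑ˢ n (g k r) + ∑[ r < n ] ∑ˢ n (rest r)
    ≡⟨ cong (∑[ r < n ] ∑ˢ n (g k r) +_) (∑∑ˢ-sumˡ-comm g ks) ⟩
  ∑[ r < n ] ∑ˢ n (g k r) + sumˡ (map (λ k′ → ∑[ r < n ] ∑ˢ n (g k′ r)) ks) ∎
  where
  open ≡-Reasoning
  rest : Fin n → Subset n → ℕ
  rest r A = sumˡ (map (λ k′ → g k′ r A) ks)

module _ {n} {L : Matrix n} where

  symbols : ∀ {m R C} → IsSubsquare L m R C → Subset n
  symbols (_ , _ , S , _) = S

  ∣symbols∣≡m : ∀ {m R C} (sq : IsSubsquare L m R C) → ∣ symbols sq ∣ ≡ m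
  ∣symbols∣≡m (_ , _ , _ , ∣S∣≡m , _) = ∣S∣≡m

  entry∈symbols : ∀ {m R C i j} (sq : IsSubsquare L m R C) → i ∈ R → j ∈ C → L i j ∈ symbols sq
  entry∈symbols (_ , _ , _ , _ , entry∈S , _) = entry∈S _ _

  symbol-in-row : ∀ {m R C i s} (sq : IsSubsquare L m R C) → i ∈ R → s ∈ symbols sq →
                  ∃ λ j → j ∈ C × L i j ≡ s
  symbol-in-row (_ , _ , _ , _ , _ , in-row , _) i∈R s∈S =
    let (j , j∈C , Lij≡s , _) = in-row _ _ i∈R s∈S in j , j∈C , Lij≡s

module LatinSquare {n} {L : Matrix n} (latin : IsLatinSquare L) where

  row-injective : ∀ {i j j′} → L i j ≡ L i j′ → j ≡ j′
  row-injective {i} {j} {j′} Lij≡Lij′ =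
    let (_ , _ , unique) = proj₁ latin i (L i j) in trans (unique j refl) (sym (unique j′ (sym Lij≡Lij′)))

  column-injective : ∀ {i i′ j} → L i j ≡ L i′ j → i ≡ i′
  column-injective {i} {i′} {j} Lij≡Li′j =
    let (_ , _ , unique) = proj₂ latin j (L i j) in trans (unique i refl) (sym (unique i′ (sym Lij≡Li′j)))

  row-containing : Fin n → Fin n → Fin n
  row-containing s j = proj₁ (proj₂ latin j s)

  L[row-containing]≡ : ∀ s j → L (row-containing s j) j ≡ s
  L[row-containing]≡ s j = proj₁ (proj₂ (proj₂ latin j s))

  symbol⇒∈columns : ∀ {m R C i j} (sq : IsSubsquare L m R C) → i ∈ R → L i j ∈ symbols sq → j ∈ C
  symbol⇒∈columns sq i∈R Lij∈S =
    let (j′ , j′∈C , Lij′≡Lij) = symbol-in-row sq i∈R Lij∈S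
    in subst (_∈ _) (row-injective Lij′≡Lij) j′∈C

  symbol⇒∈rows : ∀ {m R C i j} (sq : IsSubsquare L m R C) → j ∈ C → L i j ∈ symbols sq → i ∈ R
  symbol⇒∈rows (_ , _ , _ , _ , _ , _ , in-column) j∈C Lij∈S =
    let (i′ , i′∈R , Li′j≡Lij , _) = in-column _ _ j∈C Lij∈S
    in subst (_∈ _) (column-injective Li′j≡Lij) i′∈R

  columns-⊆ : ∀ {m R₁ C₁ R₂ C₂ r A a₀} (sq₁ : IsSubsquare L m R₁ C₁) (sq₂ : IsSubsquare L m R₂ C₂) →
              r ∈ R₁ → r ∈ R₂ → A ⊆ C₁ → A ⊆ C₂ → a₀ ∈ A → m < ∣ A ∣ + ∣ A ∣ → C₁ ⊆ C₂
  columns-⊆ {m} {R₁} {C₁} {R₂} {C₂} {r} {A} {a₀}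
            sq₁ sq₂ r∈R₁ r∈R₂ A⊆C₁ A⊆C₂ a₀∈A m<∣A∣+∣A∣ {j₀} j₀∈C₁ with j₀ ∈? C₂
  ... | yes j₀∈C₂ = j₀∈C₂
  ... | no  j₀∉C₂ = ⊥-elim (<⇒≱ m<∣A∣+∣A∣ (subst (∣ A ∣ + ∣ A ∣ ≤_) (∣symbols∣≡m sq₁)
                      (∣p∣+∣p′∣≤∣q∣ (symbols sq₁) f∈S₁ g∈S₁ f-inj g-inj f≢g)))
    where
    s₀ : Fin n
    s₀ = L r a₀

    ρ : Fin n → Fin n
    ρ = row-containing s₀

    ρ∈rows : ∀ {R C a} (sq : IsSubsquare L m R C) → r ∈ R → A ⊆ C → a ∈ A → ρ a ∈ R
    ρ∈rows {a = a} sq r∈R A⊆C a∈A = symbol⇒∈rows sq (A⊆C a∈A)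
      (subst (_∈ symbols sq) (sym (L[row-containing]≡ s₀ a)) (entry∈symbols sq r∈R (A⊆C a₀∈A)))

    f g : Fin n → Fin n
    f a = L r a
    g a = L (ρ a) j₀

    f∈S₁ : ∀ {a} → a ∈ A → f a ∈ symbols sq₁
    f∈S₁ a∈A = entry∈symbols sq₁ r∈R₁ (A⊆C₁ a∈A)

    g∈S₁ : ∀ {a} → a ∈ A → g a ∈ symbols sq₁
    g∈S₁ a∈A = entry∈symbols sq₁ (ρ∈rows sq₁ r∈R₁ A⊆C₁ a∈A) j₀∈C₁

    f-inj : InjectiveOn A f
    f-inj _ _ = row-injective

    g-inj : InjectiveOn A g
    g-inj {a} {a′} _ _ ga≡ga′ = row-injective (begin
      L (ρ a) a   ≡⟨ L[row-containing]≡ s₀ a ⟩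
      s₀          ≡⟨ L[row-containing]≡ s₀ a′ ⟨
      L (ρ a′) a′ ≡⟨ cong (λ i → L i a′) (column-injective ga≡ga′) ⟨
      L (ρ a) a′  ∎)
      where open ≡-Reasoning

    f≢g : ∀ {a a′} → a ∈ A → a′ ∈ A → f a ≢ g a′
    f≢g a∈A a′∈A fa≡ga′ = j₀∉C₂ (symbol⇒∈columns sq₂ (ρ∈rows sq₂ r∈R₂ A⊆C₂ a′∈A)
      (subst (_∈ symbols sq₂) fa≡ga′ (entry∈symbols sq₂ r∈R₂ (A⊆C₂ a∈A))))

  rows-⊆ : ∀ {m R₁ C₁ R₂ C₂ r a} (sq₁ : IsSubsquare L m R₁ C₁) (sq₂ : IsSubsquare L m R₂ C₂) →
           r ∈ R₁ → r ∈ R₂ → a ∈ C₁ → C₁ ⊆ C₂ → R₁ ⊆ R₂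
  rows-⊆ sq₁ sq₂ r∈R₁ r∈R₂ a∈C₁ C₁⊆C₂ i∈R₁ =
    let (j , j∈C₁ , Lrj≡Lia) = symbol-in-row sq₁ r∈R₁ (entry∈symbols sq₁ i∈R₁ a∈C₁)
    in symbol⇒∈rows sq₂ (C₁⊆C₂ a∈C₁)
         (subst (_∈ symbols sq₂) Lrj≡Lia (entry∈symbols sq₂ r∈R₂ (C₁⊆C₂ j∈C₁)))

  share-row-and-columns⇒≡ : ∀ {m R₁ C₁ R₂ C₂ r A} → IsSubsquare L m R₁ C₁ → IsSubsquare L m R₂ C₂ →
                            r ∈ R₁ → r ∈ R₂ → A ⊆ C₁ → A ⊆ C₂ → m < ∣ A ∣ + ∣ A ∣ →
                            (R₁ , C₁) ≡ (R₂ , C₂)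
  share-row-and-columns⇒≡ {R₁ = R₁} {C₁} {R₂} {C₂} {A = A} sq₁ sq₂ r∈R₁ r∈R₂ A⊆C₁ A⊆C₂ m<∣A∣+∣A∣ with nonempty? A
  ... | no A-empty = ⊥-elim (n≮0 (subst (λ k → _ < k + k) ∣A∣≡0 m<∣A∣+∣A∣))
    where
    ∣A∣≡0 : ∣ A ∣ ≡ 0
    ∣A∣≡0 = trans (cong ∣_∣ (Empty-unique A-empty)) (∣⊥∣≡0 n)
  ... | yes (a₀ , a₀∈A) = cong₂ _,_ (⊆-antisym R₁⊆R₂ R₂⊆R₁) (⊆-antisym C₁⊆C₂ C₂⊆C₁)
    where
    C₁⊆C₂ : C₁ ⊆ C₂
    C₁⊆C₂ = columns-⊆ sq₁ sq₂ r∈R₁ r∈R₂ A⊆C₁ A⊆C₂ a₀∈A m<∣A∣+∣A∣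
    C₂⊆C₁ : C₂ ⊆ C₁
    C₂⊆C₁ = columns-⊆ sq₂ sq₁ r∈R₂ r∈R₁ A⊆C₂ A⊆C₁ a₀∈A m<∣A∣+∣A∣
    R₁⊆R₂ : R₁ ⊆ R₂
    R₁⊆R₂ = rows-⊆ sq₁ sq₂ r∈R₁ r∈R₂ (A⊆C₁ a₀∈A) C₁⊆C₂
    R₂⊆R₁ : R₂ ⊆ R₁
    R₂⊆R₁ = rows-⊆ sq₂ sq₁ r∈R₂ r∈R₁ (A⊆C₂ a₀∈A) C₂⊆C₁

Flag : ∀ {n} → ℕ → Subset n × Subset n → Fin n → Subset n → Set
Flag h (R , C) r A = r ∈ R × A ⊆ C × ∣ A ∣ ≡ h

flag? : ∀ {n} h (RC : Subset n × Subset n) r A → Dec (Flag h RC r A)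
flag? h (R , C) r A = r ∈? R ×-dec A ⊆? C ×-dec ∣ A ∣ ≟ h

#flags : ∀ {n} → ℕ → Subset n × Subset n → ℕ
#flags {n} h RC = ∑[ r < n ] ∑ˢ n (λ A → 𝟙 (flag? h RC r A))

#flags≡ : ∀ {n} h (R D : Subset n) → #flags h (R , D) ≡ ∣ R ∣ * (∣ D ∣ C h)
#flags≡ {n} h R D = begin
  ∑[ r < n ] ∑ˢ n (λ A → 𝟙 (flag? h (R , D) r A))
    ≡⟨ sum-cong-≗ (λ r → ∑ˢ-cong n (λ A → 𝟙-×-dec (r ∈? R) (A ⊆? D ×-dec ∣ A ∣ ≟ h))) ⟩
  ∑[ r < n ] ∑ˢ n (λ A → 𝟙 (r ∈? R) * 𝟙[⊆×∣∣≡] A)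
    ≡⟨ sum-cong-≗ (λ r → *-distribˡ-∑ˢ n (𝟙 (r ∈? R)) 𝟙[⊆×∣∣≡]) ⟨
  ∑[ r < n ] (𝟙 (r ∈? R) * ∑ˢ n 𝟙[⊆×∣∣≡])
    ≡⟨ *-distribʳ-sum (∑ˢ n 𝟙[⊆×∣∣≡]) (λ r → 𝟙 (r ∈? R)) ⟨
  (∑[ r < n ] 𝟙 (r ∈? R)) * ∑ˢ n 𝟙[⊆×∣∣≡]
    ≡⟨ cong₂ _*_ (sym (∣p∣≡∑𝟙[∈] R)) (∑ˢ-𝟙[⊆×∣∣≡] D h) ⟩
  ∣ R ∣ * (∣ D ∣ C h) ∎
  where
  open ≡-Reasoning
  𝟙[⊆×∣∣≡] : Subset n → ℕ
  𝟙[⊆×∣∣≡] A = 𝟙 (A ⊆? D ×-dec ∣ A ∣ ≟ h)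

flags-packing : ∀ {n q} h M {Q : Pred (Subset n × Subset n) q} {ks} → Unique ks → All Q ks →
                (∀ {k} → Q k → #flags h k ≡ M) →
                (∀ {k k′ r A} → Q k → Q k′ → Flag h k r A → Flag h k′ r A → k ≡ k′) →
                length ks * M ≤ #flags h (⊤ {n} , ⊤)
flags-packing {n} h M {ks = ks} distinct Qks #flags≡M unique = begin
  length ks * M
    ≡⟨ sumˡ-const (All.map #flags≡M Qks) ⟨
  sumˡ (map (#flags h) ks)
    ≡⟨ ∑∑ˢ-sumˡ-comm (λ k r A → 𝟙 (flag? h k r A)) ks ⟨
  ∑[ r < n ] ∑ˢ n (λ A → sumˡ (map (λ k → 𝟙 (flag? h k r A)) ks))
    ≤⟨ ∑-mono (λ r → ∑ˢ-mono n (covered≤𝟙 r)) ⟩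
  #flags h (⊤ {n} , ⊤) ∎
  where
  open ≤-Reasoning

  flag⇒flag⊤ : ∀ {k r A} → Flag h k r A → Flag h (⊤ , ⊤) r A
  flag⇒flag⊤ (_ , _ , ∣A∣≡h) = ∈⊤ , ⊆⊤ , ∣A∣≡h

  covered≤𝟙 : ∀ r A → sumˡ (map (λ k → 𝟙 (flag? h k r A)) ks) ≤ 𝟙 (flag? h (⊤ , ⊤) r A)
  covered≤𝟙 r A = sumˡ-𝟙≤𝟙 (λ k → flag? h k r A) (flag? h (⊤ , ⊤) r A) distinct Qks flag⇒flag⊤ unique

m<⌈1+m/2⌉+⌈1+m/2⌉ : ∀ m → m < ⌈ suc m /2⌉ + ⌈ suc m /2⌉
m<⌈1+m/2⌉+⌈1+m/2⌉ m = begin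
  suc m                          ≡⟨ ⌊n/2⌋+⌈n/2⌉≡n (suc m) ⟨
  ⌊ suc m /2⌋ + ⌈ suc m /2⌉      ≤⟨ +-monoˡ-≤ ⌈ suc m /2⌉ (⌊n/2⌋≤⌈n/2⌉ (suc m)) ⟩
  ⌈ suc m /2⌉ + ⌈ suc m /2⌉      ∎
  where open ≤-Reasoning

theorem2p1 : (m n : ℕ) → 1 ≤ m → 1 ≤ n →
    (L : Matrix n) → IsLatinSquare L →
    (subs : List (Subset n × Subset n)) → Unique subs →
    All (λ RC → IsSubsquare L m (proj₁ RC) (proj₂ RC)) subs →
    length subs * (m * (m C ⌈ suc m /2⌉)) ≤ n * (n C ⌈ suc m /2⌉)
theorem2p1 m n _ _ L latin subs distinct subsquares = begin
  length subs * (m * (m C h))  ≤⟨ flags-packing h (m * (m C h)) distinct subsquares subsquare-#flags flag-unique ⟩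
  #flags h (⊤ {n} , ⊤)         ≡⟨ #flags≡ {n} h ⊤ ⊤ ⟩
  ∣ ⊤ {n} ∣ * (∣ ⊤ {n} ∣ C h)  ≡⟨ cong (λ k → k * (k C h)) (∣⊤∣≡n n) ⟩
  n * (n C h)                  ∎
  where
  open ≤-Reasoning
  open LatinSquare latin
  h : ℕ
  h = ⌈ suc m /2⌉

  subsquare-#flags : ∀ {RC} → IsSubsquare L m (proj₁ RC) (proj₂ RC) → #flags h RC ≡ m * (m C h)
  subsquare-#flags {R , D} (∣R∣≡m , ∣D∣≡m , _) =
    trans (#flags≡ h R D) (cong₂ (λ a b → a * (b C h)) ∣R∣≡m ∣D∣≡m)

  flag-unique : ∀ {k k′ r A} → IsSubsquare L m (proj₁ k) (proj₂ k) → IsSubsquare L m (proj₁ k′) (proj₂ k′) →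
                Flag h k r A → Flag h k′ r A → k ≡ k′
  flag-unique sq sq′ (r∈R , A⊆C , ∣A∣≡h) (r∈R′ , A⊆C′ , _) =
    share-row-and-columns⇒≡ sq sq′ r∈R r∈R′ A⊆C A⊆C′
      (subst (λ a → m < a + a) (sym ∣A∣≡h) (m<⌈1+m/2⌉+⌈1+m/2⌉ m))
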